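{- Fix a job $s$, an index $k'$, and a time $\theta\ge r_s$ such that for each job $j\le k'$ with $r_s\le r_j<\theta$ we have $C^*_{s,j}\le\theta$. Suppose there is an $(s,k')$-schedule $Q$ with $C_{\max}(Q)>\theta$ and at most $g$ gaps. Then there is an $(s,k')$-schedule $R$ that schedules all jobs $j\le k'$ with $r_s\le r_j<\theta$ and satisfies: (a) $C_{\max}(R)\le\theta$ and $R$ has at most $g$ gaps; and (b) if $C_{\max}(R)<\theta$ then $R$ has strictly fewer than $g$ gaps.
   Context: Time is discrete, divided into unit slots $[t,t+1)$ (slot $t$). There are $n$ jobs $1,\dots,n$; job $j$ has integer release time $r_j$, deadline $d_j$ and positive integer processing time $p_j$. A (partial, preemptive) schedule assigns to each slot at most one job, and each job it schedules receives exactly $p_j$ slots in $[r_j,d_j)$; $C_j(S)$ is the completion time of $j$ and $C_{\max}(S)=\max_jC_j(S)$. Standing assumptions: $d_1<\dots<d_n$, release times pairwise distinct, the instance is feasible, and all schedules have the earliest-deadline property (at each slot, $S$ is idle or executes, among its scheduled jobs that are released and not completed, the one of smallest deadline). An $(s,k)$-schedule is a partial schedule $S$ with $C_{\max}(S)\le d_k$ whose set of scheduled jobs is exactly $\{j\le k: r_s\le r_j<C_{\max}(S)\}$; the empty schedule counts, with completion time $r_s$. The number of gaps of an $(s,k)$-schedule is the number of maximal finite idle intervals between its blocks (maximal busy intervals) plus one if the interval between $r_s$ and the first block is nonempty. For a job $j$ with $r_j\ge r_s$, $C^*_{s,j}$ is the minimum completion time of $j$ among all $(s,k)$-schedules that schedule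 $j$, for any $k\ge j$ (this value does not depend on $k$). -}

module Defs where

open import Data.Nat using (ℕ; zero; suc; _+_; _∸_; _≤_; _<_; _≡ᵇ_; pred)
open import Data.Fin as Fin using (Fin)
open import Data.Bool using (Bool; true; false; if_then_else_; _∧_; _∨_; not)
open import Data.Maybe using (Maybe; just; nothing)
open import Data.Product using (Σ; _×_; _,_; ∃)
open import Data.Sum using (_⊎_)
open import Relation.Nullary using (¬_; yes; no)
open import Relation.Binary.PropositionalEquality using (_≡_; _≢_)
open import Function.Bundles using (_⇔_)

-- An instance with n jobs, indexed by Fin n (job i of the paper is index i-1).
-- Times are natural numbers (slot t = [t,t+1)).
record Instance (n : ℕ) : Set where
  field
    r : Fin n → ℕ
    d : Fin n → ℕ
    p : Fin n → ℕ

-- A (partial, preemptive) schedule: slot t is idle (nothing) or runs one job.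
Schedule : ℕ → Set
Schedule n = ℕ → Maybe (Fin n)

module _ {n : ℕ} (I : Instance n) where
  open Instance I

  isJob : Maybe (Fin n) → Fin n → ℕ
  isJob nothing j = 0
  isJob (just i) j with i Fin.≟ j
  ... | yes _ = 1
  ... | no _ = 0

  countSlots : Schedule n → Fin n → ℕ → ℕ → ℕ
  countSlots S j a zero = 0
  countSlots S j a (suc m) = isJob (S a) j + countSlots S j (suc a) m

  Scheduled : Schedule n → Fin n → Set
  Scheduled S j = ∃ λ t → S t ≡ just j

  Valid : Schedule n → Set
  Valid S =
    (∀ t j → S t ≡ just j → r j ≤ t × t < d j) ×
    (∀ j → Scheduled S j → countSlots S j (r j) (d j ∸ r j) ≡ p j)

  -- j is released and not yet completed at slot t (some slot ≥ t runs j)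
  Pending : Schedule n → Fin n → ℕ → Set
  Pending S i t = r i ≤ t × ∃ λ t' → t ≤ t' × S t' ≡ just i

  EDF : Schedule n → Set
  EDF S = ∀ t j → S t ≡ just j → ∀ i → Pending S i t → d j ≤ d i

  -- C_j(S) = c : j completes at time c (its last slot is c-1)
  Completion : Schedule n → Fin n → ℕ → Set
  Completion S j c = Σ ℕ λ t → suc t ≡ c × S t ≡ just j × (∀ t' → c ≤ t' → S t' ≢ just j)

  EmptySchedule : Schedule n → Set
  EmptySchedule S = ∀ t → S t ≡ nothing

  -- C_max(S) = c, with the convention C_max = base (= r_s) for the empty schedule
  IsCmax : ℕ → Schedule n → ℕ → Set
  IsCmax base S c =
    (EmptySchedule S × c ≡ base) ⊎
    ((∃ λ j → Completion S j c) × (∀ j c' → Completion S j c' → c' ≤ c))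

  SKSchedule : Fin n → Fin n → Schedule n → ℕ → Set
  SKSchedule s k S c =
    Valid S × EDF S × IsCmax (r s) S c × c ≤ d k ×
    (∀ j → Scheduled S j ⇔ (j Fin.≤ k × r s ≤ r j × r j < c))

  Feasible : Set
  Feasible = Σ (Schedule n) λ S → Valid S × EDF S × (∀ j → Scheduled S j)

  record StandingAssumptions : Set where
    field
      deadlines-increasing : ∀ i j → i Fin.< j → d i < d j
      releases-distinct    : ∀ i j → r i ≡ r j → i ≡ j
      processing-positive  : ∀ j → 1 ≤ p j
      feasible             : Feasible

  -- number of gaps of an (s,k)-schedule with C_max = c: the number of maximal
  -- idle runs inside [r_s, c), counted by their starting slots: slot t is the
  -- start of such a run iff it is idle and (t = r_s or slot t-1 is busy).
  isIdle : Maybe (Fin n) → Bool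
  isIdle nothing = true
  isIdle (just _) = false

  gapStart : Schedule n → ℕ → ℕ → ℕ
  gapStart S b t =
    if isIdle (S t) ∧ ((t ≡ᵇ b) ∨ not (isIdle (S (pred t)))) then 1 else 0

  gapsFrom : Schedule n → ℕ → ℕ → ℕ → ℕ
  gapsFrom S b t zero = 0
  gapsFrom S b t (suc m) = gapStart S b t + gapsFrom S b (suc t) m

  gaps : Fin n → Schedule n → ℕ → ℕ
  gaps s S c = gapsFrom S (r s) (r s) (c ∸ r s)

  IsCstar : Fin n → Fin n → ℕ → Set
  IsCstar s j c =
    (Σ (Fin n) λ k → Σ (Schedule n) λ S → Σ ℕ λ cm →
       j Fin.≤ k × SKSchedule s k S cm × Completion S j c) ×
    (∀ k S cm c' → j Fin.≤ k → SKSchedule s k S cm → Completion S j c' → c ≤ c')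

-- Let J be the set of jobs that R must contain. Cut Q at a slot z and let the greedy EDF
-- schedule, started at z, redo the work that Q performs on J after z. Everything rests on
-- one counting argument: if EDF leaves a job j unfinished at e, then on the maximal run
-- [a, e) in which it executes jobs of index at most j it owes more than e - a units of
-- work on such jobs, so no schedule can perform that work inside [a, e). Comparing with
-- the C*-schedules, EDF started at a slot before which none of its work is released
-- finishes it by θ; in particular the work W(z) that Q performs on J after z satisfies
-- W(r_s) ≤ θ - r_s, and since W(z) + z grows by at most one per slot, some z ∈ [r_s, θ]
-- has W(z) = θ - z. For that z, EDF is busy throughout [z, θ) (after an idle slot none
-- of its remaining work is released, so it would do θ - z units in fewer slots) and,
-- comparing with Q itself, meets every deadline. The spliced schedule agrees with Q before
-- z and has no gap in [z, θ); if it ends at some cR < θ, then cR < z and the idle slot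
-- cR starts a gap of Q that R does not have.

module Submission where

open import Defs
open import Data.Bool using (true; false; if_then_else_; _∧_; _∨_; not)
open import Data.Empty using (⊥; ⊥-elim)
open import Data.Fin as Fin using (Fin; zero; suc)
import Data.Fin.Properties as Fin
open import Data.Maybe using (Maybe; just; nothing)
open import Data.Maybe.Properties using (just-injective)
open import Data.Nat using (ℕ; zero; suc; _+_; _∸_; _≤_; _<_; z≤n; s≤s; z<s; _≤?_; _<?_; pred; _≡ᵇ_)
open import Data.Nat.Properties
open import Algebra.Properties.CommutativeMonoid.Sum +-0-commutativeMonoid using (sum; ∑-distrib-+) renaming (sum-cong-≗ to sum-cong)
open import Data.Product using (Σ; _×_; ∃; _,_; proj₁; proj₂)
open import Data.Sum using (_⊎_; inj₁; inj₂)
open import Function using (_∘_; case_of_)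
open import Function.Bundles using (_⇔_; Equivalence; mk⇔)
open import Level using (0ℓ)
open import Relation.Nullary using (¬_; Dec; yes; no; does)
open import Relation.Nullary.Decidable using (_×-dec_)
open import Relation.Unary using (Pred; Decidable)
open import Relation.Binary.PropositionalEquality
open Instance

sum-mono : ∀ {n} {f g : Fin n → ℕ} → (∀ i → f i ≤ g i) → sum f ≤ sum g
sum-mono {zero}  f≤g = z≤n
sum-mono {suc n} f≤g = +-mono-≤ (f≤g zero) (sum-mono (f≤g ∘ suc))

sum-zero : ∀ {n} (f : Fin n → ℕ) → (∀ i → f i ≡ 0) → sum f ≡ 0
sum-zero {zero}  f f≡0 = refl
sum-zero {suc n} f f≡0 = cong₂ _+_ (f≡0 zero) (sum-zero (f ∘ suc) (f≡0 ∘ suc))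

sum-single : ∀ {n} {f : Fin n → ℕ} j → (∀ i → i ≢ j → f i ≡ 0) → sum f ≡ f j
sum-single {suc n} {f} zero    f≡0 =
  trans (cong (f zero +_) (sum-zero (f ∘ suc) (λ i → f≡0 (suc i) λ ()))) (+-identityʳ _)
sum-single {suc n}     (suc j) f≡0 =
  cong₂ _+_ (f≡0 zero λ ()) (sum-single j λ i i≢j → f≡0 (suc i) (i≢j ∘ Fin.suc-injective))

≤-sum : ∀ {n} (f : Fin n → ℕ) j → f j ≤ sum f
≤-sum f zero    = m≤m+n _ _
≤-sum f (suc j) = ≤-trans (≤-sum (f ∘ suc) j) (m≤n+m _ _)

restrict : ∀ {n} {P : Pred (Fin n) 0ℓ} → Decidable P → (Fin n → ℕ) → Fin n → ℕ
restrict P? f i = if does (P? i) then f i else 0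

module _ {n} {P : Pred (Fin n) 0ℓ} (P? : Decidable P) where

  restrict-≤ : ∀ f i → restrict P? f i ≤ f i
  restrict-≤ f i with P? i
  ... | yes _ = ≤-refl
  ... | no _  = z≤n

  restrict-yes : ∀ f {i} → P i → restrict P? f i ≡ f i
  restrict-yes f {i} Pi with P? i
  ... | yes _  = refl
  ... | no ¬Pi = ⊥-elim (¬Pi Pi)

  restrict-pos : ∀ f {i} → 0 < restrict P? f i → P i
  restrict-pos f {i} pos with P? i
  ... | yes Pi = Pi
  ... | no _ with pos
  ...   | ()

  restrict-+ : ∀ f g i → restrict P? (λ i → f i + g i) i ≡ restrict P? f i + restrict P? g i
  restrict-+ f g i with P? i
  ... | yes _ = refl
  ... | no _  = refl

  restrict-cong : ∀ {f g} → (∀ i → f i ≡ g i) → ∀ i → restrict P? f i ≡ restrict P? g i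
  restrict-cong f≡g i = cong (λ x → if does (P? i) then x else 0) (f≡g i)

  restrict-mono : ∀ {f g} → (∀ i → f i ≤ g i) → ∀ i → restrict P? f i ≤ restrict P? g i
  restrict-mono f≤g i with P? i
  ... | yes _ = f≤g i
  ... | no _  = z≤n

Least : ∀ {n} → Pred (Fin n) 0ℓ → Fin n → Set
Least P i = P i × ∀ j → P j → i Fin.≤ j

least? : ∀ {n} {P : Pred (Fin n) 0ℓ} → Decidable P → ∃ (Least P) ⊎ (∀ i → ¬ P i)
least? {zero}  P? = inj₂ λ ()
least? {suc n} P? with P? zero | least? (P? ∘ suc)
... | yes P0  | _                  = inj₁ (zero , P0 , λ _ _ → z≤n)
... | no ¬P0 | inj₁ (i , Pi , min) = inj₁ (suc i , Pi , λ { zero P0 → ⊥-elim (¬P0 P0) ; (suc j) Pj → s≤s (min j Pj) })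
... | no ¬P0 | inj₂ none           = inj₂ λ { zero → ¬P0 ; (suc i) → none i }

record MaximalRun (P : Pred ℕ 0ℓ) (lo hi : ℕ) : Set where
  field
    start    : ℕ
    lo≤start : lo ≤ start
    start≤hi : start ≤ hi
    holds    : ∀ t → start ≤ t → t < hi → P t
    maximal  : start ≡ lo ⊎ ∃ λ t → suc t ≡ start × lo ≤ t × ¬ P t

maximalRun : ∀ {P : Pred ℕ 0ℓ} → Decidable P → ∀ {lo} hi → lo ≤ hi → MaximalRun P lo hi
maximalRun {P} P? {lo} hi lo≤hi with m≤n⇒m<n∨m≡n lo≤hi
... | inj₂ refl = record
  { start = lo ; lo≤start = ≤-refl ; start≤hi = ≤-refl
  ; holds = λ t lo≤t t<lo → ⊥-elim (<⇒≱ t<lo lo≤t) ; maximal = inj₁ refl }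
maximalRun {P} P? {lo} (suc h) _ | inj₁ (s≤s lo≤h) with P? h
... | no ¬Ph = record
  { start = suc h ; lo≤start = m≤n⇒m≤1+n lo≤h ; start≤hi = ≤-refl
  ; holds = λ t h<t t<h → ⊥-elim (<⇒≱ t<h h<t) ; maximal = inj₂ (h , refl , lo≤h , ¬Ph) }
... | yes Ph = record
  { start = start ; lo≤start = lo≤start ; start≤hi = m≤n⇒m≤1+n start≤hi
  ; holds = holds′ ; maximal = maximal }
  where
  open MaximalRun (maximalRun P? h lo≤h)
  holds′ : ∀ t → start ≤ t → t < suc h → P t
  holds′ t start≤t t<sh with m≤n⇒m<n∨m≡n (≤-pred t<sh)
  ... | inj₁ t<h  = holds t start≤t t<h
  ... | inj₂ refl = Ph

discrete-ivt : (f : ℕ → ℕ) → (∀ x → f (suc x) ≤ suc (f x)) →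
               ∀ {a b v} → a ≤ b → f a ≤ v → v ≤ f b → ∃ λ c → a ≤ c × c ≤ b × f c ≡ v
discrete-ivt f step {a} {b} {v} a≤b fa≤v v≤fb with m≤n⇒m<n∨m≡n a≤b
... | inj₂ refl = a , ≤-refl , ≤-refl , ≤-antisym fa≤v v≤fb
discrete-ivt f step {a} {suc b} {v} _ fa≤v v≤fb | inj₁ (s≤s a≤b) with f (suc b) ≤? v
... | yes fb≤v = suc b , m≤n⇒m≤1+n a≤b , ≤-refl , ≤-antisym fb≤v v≤fb
... | no fb≰v  with discrete-ivt f step a≤b fa≤v (≤-pred (≤-trans (≰⇒> fb≰v) (step b)))
...   | c , a≤c , c≤b , fc≡v = c , a≤c , m≤n⇒m≤1+n c≤b , fc≡v

x<x+1+m : ∀ x m → x < x + suc m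
x<x+1+m x m = m<m+n x z<s

t<1+x+m⇒t<x+1+m : ∀ {t} x m → t < suc x + m → t < x + suc m
t<1+x+m⇒t<x+1+m x m t<1+x+m = ≤-trans t<1+x+m (≤-reflexive (sym (+-suc x m)))

module SlotCounting {n : ℕ} (I : Instance n) where

  isJob-self : ∀ j → isJob I (just j) j ≡ 1
  isJob-self j with j Fin.≟ j
  ... | yes _  = refl
  ... | no j≢j = ⊥-elim (j≢j refl)

  isJob-absent : ∀ {m j} → m ≢ just j → isJob I m j ≡ 0
  isJob-absent {nothing} _ = refl
  isJob-absent {just i} {j} m≢j with i Fin.≟ j
  ... | yes refl = ⊥-elim (m≢j refl)
  ... | no _     = refl

  isJob-pos : ∀ {m j} → 0 < isJob I m j → m ≡ just j
  isJob-pos {nothing} ()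
  isJob-pos {just i} {j} pos with i Fin.≟ j | pos
  ... | yes refl | _ = refl
  ... | no _     | ()

  ∑-isJob-just : ∀ j → sum (isJob I (just j)) ≡ 1
  ∑-isJob-just j = trans (sum-single j λ i i≢j → isJob-absent (i≢j ∘ sym ∘ just-injective)) (isJob-self j)

  ∑-isJob≤1 : ∀ m → sum (isJob I m) ≤ 1
  ∑-isJob≤1 nothing  = ≤-trans (≤-reflexive (sum-zero (isJob I nothing) λ _ → refl)) z≤n
  ∑-isJob≤1 (just j) = ≤-reflexive (∑-isJob-just j)

  StartsFrom : Schedule n → Fin n → ℕ → Set
  StartsFrom S i u = ∀ t → S t ≡ just i → u ≤ t

  EndsBy : Schedule n → Fin n → ℕ → Set
  EndsBy S i v = ∀ t → S t ≡ just i → t < v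

  slotsBefore : Schedule n → Fin n → ℕ → ℕ
  slotsBefore S i t = countSlots I S i 0 t

  module _ (S : Schedule n) (i : Fin n) where

    countSlots-++ : ∀ x m m' → countSlots I S i x (m + m') ≡ countSlots I S i x m + countSlots I S i (x + m) m'
    countSlots-++ x zero    m' = cong (λ y → countSlots I S i y m') (sym (+-identityʳ x))
    countSlots-++ x (suc m) m' = begin
      isJob I (S x) i + countSlots I S i (suc x) (m + m')
        ≡⟨ cong (isJob I (S x) i +_) (countSlots-++ (suc x) m m') ⟩
      isJob I (S x) i + (countSlots I S i (suc x) m + countSlots I S i (suc x + m) m')
        ≡⟨ sym (+-assoc (isJob I (S x) i) _ _) ⟩
      isJob I (S x) i + countSlots I S i (suc x) m + countSlots I S i (suc x + m) m'
        ≡⟨ cong (λ y → isJob I (S x) i + countSlots I S i (suc x) m + countSlots I S i y m') (sym (+-suc x m)) ⟩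
      isJob I (S x) i + countSlots I S i (suc x) m + countSlots I S i (x + suc m) m' ∎
      where open ≡-Reasoning

    countSlots-monoʳ : ∀ x {m m'} → m ≤ m' → countSlots I S i x m ≤ countSlots I S i x m'
    countSlots-monoʳ x {m} {m'} m≤m' = begin
      countSlots I S i x m                                            ≤⟨ m≤m+n _ _ ⟩
      countSlots I S i x m + countSlots I S i (x + m) (m' ∸ m)        ≡⟨ countSlots-++ x m (m' ∸ m) ⟨
      countSlots I S i x (m + (m' ∸ m))                               ≡⟨ cong (countSlots I S i x) (m+[n∸m]≡n m≤m') ⟩
      countSlots I S i x m' ∎
      where open ≤-Reasoning

    countSlots-absent : ∀ x m → (∀ t → x ≤ t → t < x + m → S t ≢ just i) → countSlots I S i x m ≡ 0
    countSlots-absent x zero    _      = refl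
    countSlots-absent x (suc m) absent =
      cong₂ _+_ (isJob-absent (absent x ≤-refl (x<x+1+m x m)))
                (countSlots-absent (suc x) m λ t x<t t<1+x+m → absent t (<⇒≤ x<t) (t<1+x+m⇒t<x+1+m x m t<1+x+m))

    countSlots-pos : ∀ x m → 0 < countSlots I S i x m → ∃ λ t → x ≤ t × t < x + m × S t ≡ just i
    countSlots-pos x (suc m) pos with 0 <? isJob I (S x) i
    ... | yes here = x , ≤-refl , x<x+1+m x m , isJob-pos here
    ... | no ¬here with countSlots-pos (suc x) m (≤-trans pos (+-monoˡ-≤ _ (≮⇒≥ ¬here)))
    ...   | t , x<t , t<1+x+m , St = t , <⇒≤ x<t , t<1+x+m⇒t<x+1+m x m t<1+x+m , St

    slotsBefore-++ : ∀ x m → slotsBefore S i (x + m) ≡ slotsBefore S i x + countSlots I S i x m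
    slotsBefore-++ = countSlots-++ 0

    slotsBefore-endsBy : ∀ {v t} → EndsBy S i v → v ≤ t → slotsBefore S i t ≡ slotsBefore S i v
    slotsBefore-endsBy {v} {t} endsBy v≤t = begin
      slotsBefore S i t                                   ≡⟨ cong (slotsBefore S i) (m+[n∸m]≡n v≤t) ⟨
      slotsBefore S i (v + (t ∸ v))                       ≡⟨ slotsBefore-++ v (t ∸ v) ⟩
      slotsBefore S i v + countSlots I S i v (t ∸ v)
        ≡⟨ cong (slotsBefore S i v +_) (countSlots-absent v (t ∸ v) λ t′ v≤t′ _ St′ → <⇒≱ (endsBy t′ St′) v≤t′) ⟩
      slotsBefore S i v + 0                               ≡⟨ +-identityʳ _ ⟩
      slotsBefore S i v ∎
      where open ≡-Reasoning

    slotsBefore-startsFrom : ∀ {u t} → StartsFrom S i u → t ≤ u → slotsBefore S i t ≡ 0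
    slotsBefore-startsFrom {u} {t} startsFrom t≤u =
      countSlots-absent 0 t λ t′ _ t′<t St′ → <⇒≱ (≤-trans t′<t t≤u) (startsFrom t′ St′)

    countSlots-covering : ∀ {u v} x m → StartsFrom S i u → EndsBy S i v → x ≤ u → v ≤ x + m →
                          countSlots I S i x m ≡ slotsBefore S i v
    countSlots-covering {v = v} x m startsFrom endsBy x≤u v≤x+m = begin
      countSlots I S i x m                         ≡⟨ cong (_+ countSlots I S i x m) (slotsBefore-startsFrom startsFrom x≤u) ⟨
      slotsBefore S i x + countSlots I S i x m     ≡⟨ slotsBefore-++ x m ⟨
      slotsBefore S i (x + m)                      ≡⟨ slotsBefore-endsBy endsBy v≤x+m ⟩
      slotsBefore S i v ∎
      where open ≡-Reasoning

    countSlots≤slotsBefore : ∀ x m → countSlots I S i x m ≤ slotsBefore S i (x + m)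
    countSlots≤slotsBefore x m = ≤-trans (m≤n+m _ _) (≤-reflexive (sym (slotsBefore-++ x m)))

    countSlots-from-suc : ∀ x y → countSlots I S i (suc x) (y ∸ suc x) ≤ countSlots I S i x (y ∸ x)
    countSlots-from-suc x y with y ∸ x in eq
    ... | zero  rewrite sym (pred[m∸n]≡m∸[1+n] y x) | eq = z≤n
    ... | suc k rewrite sym (pred[m∸n]≡m∸[1+n] y x) | eq = m≤n+m _ _

  countSlots-cong : ∀ {S S′} i x m → (∀ t → x ≤ t → t < x + m → S t ≡ S′ t) →
                    countSlots I S i x m ≡ countSlots I S′ i x m
  countSlots-cong i x zero    _     = refl
  countSlots-cong i x (suc m) agree =
    cong₂ _+_ (cong (λ slot → isJob I slot i) (agree x ≤-refl (x<x+1+m x m)))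
              (countSlots-cong i (suc x) m λ t x<t t<1+x+m → agree t (<⇒≤ x<t) (t<1+x+m⇒t<x+1+m x m t<1+x+m))

  ∑-countSlots≤ : ∀ S x m → sum (λ i → countSlots I S i x m) ≤ m
  ∑-countSlots≤ S x zero    = ≤-reflexive (sum-zero (λ i → countSlots I S i x zero) λ _ → refl)
  ∑-countSlots≤ S x (suc m) = begin
    sum (λ i → isJob I (S x) i + countSlots I S i (suc x) m)            ≡⟨ ∑-distrib-+ (isJob I (S x)) _ ⟩
    sum (isJob I (S x)) + sum (λ i → countSlots I S i (suc x) m)        ≤⟨ +-mono-≤ (∑-isJob≤1 (S x)) (∑-countSlots≤ S (suc x) m) ⟩
    suc m ∎
    where open ≤-Reasoning

  ∑-restrict-isJob-just : ∀ {P : Pred (Fin n) 0ℓ} (P? : Decidable P) {j} → P j → sum (restrict P? (isJob I (just j))) ≡ 1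
  ∑-restrict-isJob-just P? {j} Pj = begin
    sum (restrict P? (isJob I (just j)))     ≡⟨ sum-single j elsewhere ⟩
    restrict P? (isJob I (just j)) j         ≡⟨ restrict-yes P? (isJob I (just j)) Pj ⟩
    isJob I (just j) j                       ≡⟨ isJob-self j ⟩
    1 ∎
    where
    open ≡-Reasoning
    elsewhere : ∀ i → i ≢ j → restrict P? (isJob I (just j)) i ≡ 0
    elsewhere i i≢j = n≤0⇒n≡0 (≤-trans (restrict-≤ P? (isJob I (just j)) i)
                                       (≤-reflexive (isJob-absent (i≢j ∘ sym ∘ just-injective))))

  ∑-countSlots-busy : ∀ S x m → (∀ t → x ≤ t → t < x + m → S t ≢ nothing) → sum (λ i → countSlots I S i x m) ≡ m
  ∑-countSlots-busy S x zero    _    = sum-zero (λ i → countSlots I S i x zero) λ _ → refl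
  ∑-countSlots-busy S x (suc m) busy with S x in Sx
  ... | nothing = ⊥-elim (busy x ≤-refl (x<x+1+m x m) Sx)
  ... | just j  = begin
    sum (λ i → isJob I (just j) i + countSlots I S i (suc x) m)         ≡⟨ ∑-distrib-+ (isJob I (just j)) _ ⟩
    sum (isJob I (just j)) + sum (λ i → countSlots I S i (suc x) m)     ≡⟨ cong₂ _+_ (∑-isJob-just j) (∑-countSlots-busy S (suc x) m busy′) ⟩
    suc m ∎
    where
    open ≡-Reasoning
    busy′ : ∀ t → suc x ≤ t → t < suc x + m → S t ≢ nothing
    busy′ t x<t t<1+x+m = busy t (<⇒≤ x<t) (t<1+x+m⇒t<x+1+m x m t<1+x+m)

module ScheduleFacts {n : ℕ} (I : Instance n) where
  open SlotCounting I

  module _ {S : Schedule n} (valid : Valid I S) where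

    valid-startsFrom : ∀ i → StartsFrom S i (r I i)
    valid-startsFrom i t St = proj₁ (proj₁ valid t i St)

    valid-endsBy : ∀ i → EndsBy S i (d I i)
    valid-endsBy i t St = proj₂ (proj₁ valid t i St)

    valid-work : ∀ i → Scheduled I S i → slotsBefore S i (d I i) ≡ p I i
    valid-work i scheduled = trans
      (sym (countSlots-covering S i (r I i) (d I i ∸ r I i) (valid-startsFrom i) (valid-endsBy i) ≤-refl (m≤n+m∸n (d I i) (r I i))))
      (proj₂ valid i scheduled)

  completion-endsBy : ∀ {S j c} → Completion I S j c → EndsBy S j c
  completion-endsBy {c = c} (_ , _ , _ , after) t St with t <? c
  ... | yes t<c = t<c
  ... | no t≮c  = ⊥-elim (after t (≮⇒≥ t≮c) St)

  -- a job of smaller deadline that is pending when j runs its last slot would have been run instead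
  edf-endsBy-completion : ∀ {S i j c} → EDF I S → Completion I S j c → d I i < d I j → r I i < c → EndsBy S i c
  edf-endsBy-completion {S} {i} {j} {c} edf (t , 1+t≡c , St , _) di<dj ri<c t′ St′ with t′ <? c
  ... | yes t′<c = t′<c
  ... | no t′≮c  = ⊥-elim (<⇒≱ di<dj (edf t j St i (≤-pred (≤-trans ri<c (≤-reflexive (sym 1+t≡c))) , t′ , t≤t′ , St′)))
    where t≤t′ = ≤-trans (n≤1+n t) (≤-trans (≤-reflexive 1+t≡c) (≮⇒≥ t′≮c))

∸-telescope : ∀ {x y w} → x ≤ y → y ≤ w → (y ∸ x) + (w ∸ y) ≡ w ∸ x
∸-telescope {x} {y} {w} x≤y y≤w = begin
  (y ∸ x) + (w ∸ y)             ≡⟨ m+n∸m≡n x _ ⟨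
  x + ((y ∸ x) + (w ∸ y)) ∸ x   ≡⟨ cong (_∸ x) (+-assoc x (y ∸ x) (w ∸ y)) ⟨
  x + (y ∸ x) + (w ∸ y) ∸ x     ≡⟨ cong (λ v → v + (w ∸ y) ∸ x) (m+[n∸m]≡n x≤y) ⟩
  y + (w ∸ y) ∸ x               ≡⟨ cong (_∸ x) (m+[n∸m]≡n y≤w) ⟩
  w ∸ x ∎
  where open ≡-Reasoning

module GapCounting {n : ℕ} (I : Instance n) (b : ℕ) where

  gapsFrom-++ : ∀ S x m m' → gapsFrom I S b x (m + m') ≡ gapsFrom I S b x m + gapsFrom I S b (x + m) m'
  gapsFrom-++ S x zero    m' = cong (λ y → gapsFrom I S b y m') (sym (+-identityʳ x))
  gapsFrom-++ S x (suc m) m' = begin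
    gapStart I S b x + gapsFrom I S b (suc x) (m + m')
      ≡⟨ cong (gapStart I S b x +_) (gapsFrom-++ S (suc x) m m') ⟩
    gapStart I S b x + (gapsFrom I S b (suc x) m + gapsFrom I S b (suc x + m) m')
      ≡⟨ sym (+-assoc (gapStart I S b x) _ _) ⟩
    gapStart I S b x + gapsFrom I S b (suc x) m + gapsFrom I S b (suc x + m) m'
      ≡⟨ cong (λ y → gapStart I S b x + gapsFrom I S b (suc x) m + gapsFrom I S b y m') (sym (+-suc x m)) ⟩
    gapStart I S b x + gapsFrom I S b (suc x) m + gapsFrom I S b (x + suc m) m' ∎
    where open ≡-Reasoning

  gapsFrom-mono : ∀ S x {m m'} → m ≤ m' → gapsFrom I S b x m ≤ gapsFrom I S b x m'
  gapsFrom-mono S x {m} {m'} m≤m' = begin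
    gapsFrom I S b x m                                       ≤⟨ m≤m+n _ _ ⟩
    gapsFrom I S b x m + gapsFrom I S b (x + m) (m' ∸ m)     ≡⟨ gapsFrom-++ S x m (m' ∸ m) ⟨
    gapsFrom I S b x (m + (m' ∸ m))                          ≡⟨ cong (gapsFrom I S b x) (m+[n∸m]≡n m≤m') ⟩
    gapsFrom I S b x m' ∎
    where open ≤-Reasoning

  gapsFrom-split : ∀ S {x y w} → x ≤ y → y ≤ w → gapsFrom I S b x (w ∸ x) ≡ gapsFrom I S b x (y ∸ x) + gapsFrom I S b y (w ∸ y)
  gapsFrom-split S {x} {y} {w} x≤y y≤w = begin
    gapsFrom I S b x (w ∸ x)                                           ≡⟨ cong (gapsFrom I S b x) (∸-telescope x≤y y≤w) ⟨
    gapsFrom I S b x ((y ∸ x) + (w ∸ y))                               ≡⟨ gapsFrom-++ S x (y ∸ x) (w ∸ y) ⟩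
    gapsFrom I S b x (y ∸ x) + gapsFrom I S b (x + (y ∸ x)) (w ∸ y)    ≡⟨ cong (λ v → gapsFrom I S b x (y ∸ x) + gapsFrom I S b v (w ∸ y)) (m+[n∸m]≡n x≤y) ⟩
    gapsFrom I S b x (y ∸ x) + gapsFrom I S b y (w ∸ y) ∎
    where open ≡-Reasoning

  -- gapStart at x also inspects slot x - 1
  gapsFrom-cong : ∀ {S S′} x m → (∀ t → t < x + m → S t ≡ S′ t) → gapsFrom I S b x m ≡ gapsFrom I S′ b x m
  gapsFrom-cong x zero    _     = refl
  gapsFrom-cong x (suc m) agree =
    cong₂ _+_ (cong₂ (λ here prev → if isIdle I here ∧ ((x ≡ᵇ b) ∨ not (isIdle I prev)) then 1 else 0)
                     (agree x (x<x+1+m x m)) (agree (pred x) (≤-<-trans pred[n]≤n (x<x+1+m x m))))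
              (gapsFrom-cong (suc x) m λ t t<1+x+m → agree t (t<1+x+m⇒t<x+1+m x m t<1+x+m))

  gapsFrom-busy : ∀ S x m → (∀ t → x ≤ t → t < x + m → S t ≢ nothing) → gapsFrom I S b x m ≡ 0
  gapsFrom-busy S x zero    _    = refl
  gapsFrom-busy S x (suc m) busy = cong₂ _+_ busy-here
    (gapsFrom-busy S (suc x) m λ t x<t t<1+x+m → busy t (<⇒≤ x<t) (t<1+x+m⇒t<x+1+m x m t<1+x+m))
    where
    busy-here : gapStart I S b x ≡ 0
    busy-here with S x in Sx
    ... | just _  = refl
    ... | nothing = ⊥-elim (busy x ≤-refl (x<x+1+m x m) Sx)

  gapStart-idle : ∀ S t → S t ≡ nothing → (t ≡ b ⊎ ∃ λ j → S (pred t) ≡ just j) → gapStart I S b t ≡ 1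
  gapStart-idle S t St (inj₁ refl) rewrite St with t ≡ᵇ t | ≡⇒≡ᵇ t t refl
  ... | true | _ = refl
  gapStart-idle S t St (inj₂ (j , Spt)) rewrite St | Spt with t ≡ᵇ b
  ... | true  = refl
  ... | false = refl

module Greedy {n : ℕ} (I : Instance n) (z : ℕ) (ρ : Fin n → ℕ) where
  open SlotCounting I

  Ready : ℕ → (Fin n → ℕ) → Pred (Fin n) 0ℓ
  Ready t left i = r I i ≤ t × 0 < left i

  ready? : ∀ t left → Decidable (Ready t left)
  ready? t left i = r I i ≤? t ×-dec 0 <? left i

  -- with increasing deadlines the ready job of least index is the one of earliest deadline
  choose : ℕ → (Fin n → ℕ) → Maybe (Fin n)
  choose t left with z ≤? t | least? (ready? t left)
  ... | yes _ | inj₁ (i , _) = just i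
  ... | yes _ | inj₂ _       = nothing
  ... | no _  | _            = nothing

  remaining : ℕ → Fin n → ℕ
  remaining zero      = ρ
  remaining (suc t) i = remaining t i ∸ isJob I (choose t (remaining t)) i

  greedy : Schedule n
  greedy t = choose t (remaining t)

  greedy-just : ∀ {t i} → greedy t ≡ just i → z ≤ t × Least (Ready t (remaining t)) i
  greedy-just {t} eq with z ≤? t | least? (ready? t (remaining t))
  greedy-just refl | yes z≤t | inj₁ (_ , least) = z≤t , least

  greedy-idle : ∀ {t} → greedy t ≡ nothing → z ≤ t → ∀ i → ¬ Ready t (remaining t) i
  greedy-idle {t} eq z≤t with z ≤? t | least? (ready? t (remaining t))
  ... | yes _  | inj₂ none = none
  ... | no z≰t | _         = ⊥-elim (z≰t z≤t)

  greedy-before-start : ∀ {t} → t < z → greedy t ≡ nothing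
  greedy-before-start {t} t<z with z ≤? t | least? (ready? t (remaining t))
  ... | yes z≤t | _ = ⊥-elim (<⇒≱ t<z z≤t)
  ... | no _    | _ = refl

  greedy-released : ∀ {t i} → greedy t ≡ just i → r I i ≤ t
  greedy-released = proj₁ ∘ proj₁ ∘ proj₂ ∘ greedy-just

  greedy-unfinished : ∀ {t i} → greedy t ≡ just i → 0 < remaining t i
  greedy-unfinished = proj₂ ∘ proj₁ ∘ proj₂ ∘ greedy-just

  greedy-least : ∀ {t i} → greedy t ≡ just i → ∀ i′ → Ready t (remaining t) i′ → i Fin.≤ i′
  greedy-least = proj₂ ∘ proj₂ ∘ greedy-just

  remaining-step : ∀ t i → remaining t i ≡ isJob I (greedy t) i + remaining (suc t) i
  remaining-step t i with greedy t in eq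
  ... | nothing = refl
  ... | just j with j Fin.≟ i
  ...   | no _     = refl
  ...   | yes refl = sym (m+[n∸m]≡n (greedy-unfinished eq))

  remaining-anti : ∀ {t t′} i → t ≤ t′ → remaining t′ i ≤ remaining t i
  remaining-anti {t} i t≤t′ with m≤n⇒m<n∨m≡n t≤t′
  ... | inj₂ refl = ≤-refl
  remaining-anti {t} {suc t′} i _ | inj₁ (s≤s t≤t′) =
    ≤-trans (≤-trans (m≤n+m _ _) (≤-reflexive (sym (remaining-step t′ i)))) (remaining-anti i t≤t′)

  remaining≤ρ : ∀ t i → remaining t i ≤ ρ i
  remaining≤ρ t i = remaining-anti {0} {t} i z≤n

  remaining-until-start : ∀ {t} i → t ≤ z → remaining t i ≡ ρ i
  remaining-until-start {zero}  i _   = refl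
  remaining-until-start {suc t} i t<z rewrite greedy-before-start t<z = remaining-until-start i (<⇒≤ t<z)

  greedy-pending : ∀ {t t′ i} → greedy t′ ≡ just i → t ≤ t′ → 0 < remaining t i
  greedy-pending eq t≤t′ = ≤-trans (greedy-unfinished eq) (remaining-anti _ t≤t′)

  countSlots-greedy : ∀ i x m → countSlots I greedy i x m + remaining (x + m) i ≡ remaining x i
  countSlots-greedy i x zero    = cong (λ y → remaining y i) (+-identityʳ x)
  countSlots-greedy i x (suc m) = begin
    isJob I (greedy x) i + countSlots I greedy i (suc x) m + remaining (x + suc m) i
      ≡⟨ cong (λ y → isJob I (greedy x) i + countSlots I greedy i (suc x) m + remaining y i) (+-suc x m) ⟩
    isJob I (greedy x) i + countSlots I greedy i (suc x) m + remaining (suc x + m) i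
      ≡⟨ +-assoc (isJob I (greedy x) i) _ _ ⟩
    isJob I (greedy x) i + (countSlots I greedy i (suc x) m + remaining (suc x + m) i)
      ≡⟨ cong (isJob I (greedy x) i +_) (countSlots-greedy i (suc x) m) ⟩
    isJob I (greedy x) i + remaining (suc x) i
      ≡⟨ remaining-step x i ⟨
    remaining x i ∎
    where open ≡-Reasoning

  ∑remaining : ℕ → ℕ
  ∑remaining t = sum (remaining t)

  ∑remaining-window : ∀ x m → ∑remaining x ≡ sum (λ i → countSlots I greedy i x m) + ∑remaining (x + m)
  ∑remaining-window x m = begin
    sum (remaining x)                                                      ≡⟨ sum-cong (λ i → countSlots-greedy i x m) ⟨
    sum (λ i → countSlots I greedy i x m + remaining (x + m) i)             ≡⟨ ∑-distrib-+ (λ i → countSlots I greedy i x m) _ ⟩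
    sum (λ i → countSlots I greedy i x m) + ∑remaining (x + m) ∎
    where open ≡-Reasoning

  ∑remaining-drop : ∀ x m → ∑remaining x ≤ m + ∑remaining (x + m)
  ∑remaining-drop x m = ≤-trans (≤-reflexive (∑remaining-window x m)) (+-monoˡ-≤ _ (∑-countSlots≤ greedy x m))

  ∑remaining-busy : ∀ x m → (∀ t → x ≤ t → t < x + m → greedy t ≢ nothing) → ∑remaining x ≡ m + ∑remaining (x + m)
  ∑remaining-busy x m busy = trans (∑remaining-window x m) (cong (_+ ∑remaining (x + m)) (∑-countSlots-busy greedy x m busy))

  ∑remaining-idle : ∀ t → greedy t ≡ nothing → ∑remaining t ≡ ∑remaining (suc t)
  ∑remaining-idle t idle = begin
    ∑remaining t                                                  ≡⟨ ∑remaining-window t 1 ⟩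
    sum (λ i → isJob I (greedy t) i + 0) + ∑remaining (t + 1)
      ≡⟨ cong₂ _+_ (sum-zero _ λ i → cong (λ slot → isJob I slot i + 0) idle) (cong ∑remaining (+-comm t 1)) ⟩
    ∑remaining (suc t) ∎
    where open ≡-Reasoning

  Covers : Schedule n → Fin n → ℕ → ℕ → Set
  Covers S j z′ e = ∀ a i → z′ ≤ a → a ≤ e → i Fin.≤ j → r I i < e → 0 < remaining a i →
                    a ≡ z′ ⊎ a ≤ r I i → remaining a i ≤ countSlots I S i a (e ∸ a)

  module _ {j : Fin n} {z′ e : ℕ} (z≤z′ : z ≤ z′) (z′≤e : z′ ≤ e) where

    RunsUpTo : Pred ℕ 0ℓ
    RunsUpTo t = ∃ λ i → greedy t ≡ just i × i Fin.≤ j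

    runsUpTo? : Decidable RunsUpTo
    runsUpTo? t = decide (greedy t) refl
      where
      decide : ∀ slot → greedy t ≡ slot → Dec (RunsUpTo t)
      decide nothing  eq = no λ { (_ , G≡i , _) → case trans (sym eq) G≡i of λ () }
      decide (just i) eq with i Fin.≤? j
      ... | yes i≤j = yes (i , eq , i≤j)
      ... | no i≰j  = no λ { (i′ , G≡i′ , i′≤j) → i≰j (subst (Fin._≤ j) (just-injective (trans (sym G≡i′) eq)) i′≤j) }

    open MaximalRun (maximalRun runsUpTo? e z′≤e) renaming (start to a; lo≤start to z′≤a; start≤hi to a≤e)

    -- just before the run, greedy ran nothing up to j, so nothing up to j with work left was released
    released-from-run-start : ∀ i → i Fin.≤ j → 0 < remaining a i → a ≡ z′ ⊎ a ≤ r I i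
    released-from-run-start i i≤j pos with maximal
    ... | inj₁ a≡z′ = inj₁ a≡z′
    ... | inj₂ (a′ , 1+a′≡a , z′≤a′ , ¬runs) with a ≤? r I i
    ...   | yes a≤ri = inj₂ a≤ri
    ...   | no a≰ri = ⊥-elim (runs (greedy a′) refl)
      where
      ready : Ready a′ (remaining a′) i
      ready = ≤-pred (≤-trans (≰⇒> a≰ri) (≤-reflexive (sym 1+a′≡a))) ,
              ≤-trans pos (remaining-anti i (≤-trans (n≤1+n a′) (≤-reflexive 1+a′≡a)))
      runs : ∀ slot → greedy a′ ≡ slot → ⊥
      runs nothing   eq = greedy-idle eq (≤-trans z≤z′ z′≤a′) i ready
      runs (just i′) eq = ¬runs (i′ , eq , Fin.≤-trans (greedy-least eq i ready) i≤j)

    Owed : Pred (Fin n) 0ℓ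
    Owed i = i Fin.≤ j × r I i < e

    owed? : Decidable Owed
    owed? i = i Fin.≤? j ×-dec r I i <? e

    owedWork : ℕ → ℕ
    owedWork x = sum (restrict owed? (remaining x))

    owedWork-step : ∀ t → a ≤ t → t < e → owedWork t ≡ 1 + owedWork (suc t)
    owedWork-step t a≤t t<e with holds t a≤t t<e
    ... | i , G≡i , i≤j = begin
      owedWork t
        ≡⟨ sum-cong (λ i′ → trans (restrict-cong owed? (remaining-step t) i′)
                                  (restrict-+ owed? (isJob I (greedy t)) (remaining (suc t)) i′)) ⟩
      sum (λ i′ → restrict owed? (isJob I (greedy t)) i′ + restrict owed? (remaining (suc t)) i′)
        ≡⟨ ∑-distrib-+ (restrict owed? (isJob I (greedy t))) _ ⟩
      sum (restrict owed? (isJob I (greedy t))) + owedWork (suc t)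
        ≡⟨ cong (λ slot → sum (restrict owed? (isJob I slot)) + owedWork (suc t)) G≡i ⟩
      sum (restrict owed? (isJob I (just i))) + owedWork (suc t)
        ≡⟨ cong (_+ owedWork (suc t)) (∑-restrict-isJob-just owed? (i≤j , ≤-<-trans (greedy-released G≡i) t<e)) ⟩
      1 + owedWork (suc t) ∎
      where open ≡-Reasoning

    owedWork-run : ∀ k x → x + k ≡ e → a ≤ x → owedWork x ≡ k + owedWork e
    owedWork-run zero    x x+0≡e  _   = cong owedWork (trans (sym (+-identityʳ x)) x+0≡e)
    owedWork-run (suc k) x x+sk≡e a≤x =
      trans (owedWork-step x a≤x x<e) (cong suc (owedWork-run k (suc x) (trans (sym (+-suc x k)) x+sk≡e) (m≤n⇒m≤1+n a≤x)))
      where x<e = ≤-trans (s≤s (m≤m+n x k)) (≤-reflexive (trans (sym (+-suc x k)) x+sk≡e))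

    -- owedWork a counts the work owed at a; it exceeds e - a, the room any schedule has in [a, e)
    unfinished-uncoverable : 0 < remaining e j → r I j < e → ∀ S → ¬ Covers S j z′ e
    unfinished-uncoverable pos rj<e S covers = <⇒≱ owed>room owed≤room
      where
      owed-at-e : 0 < owedWork e
      owed-at-e = ≤-trans pos (≤-trans (≤-reflexive (sym (restrict-yes owed? (remaining e) (Fin.≤-refl , rj<e)))) (≤-sum _ j))
      owed>room : e ∸ a < owedWork a
      owed>room = begin-strict
        e ∸ a             ≡⟨ +-identityʳ _ ⟨
        e ∸ a + 0         <⟨ +-monoʳ-< (e ∸ a) owed-at-e ⟩
        e ∸ a + owedWork e       ≡⟨ owedWork-run (e ∸ a) a (m+[n∸m]≡n a≤e) ≤-refl ⟨
        owedWork a ∎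
        where open ≤-Reasoning
      done-by-S : ∀ i → restrict owed? (remaining a) i ≤ countSlots I S i a (e ∸ a)
      done-by-S i with 0 <? restrict owed? (remaining a) i
      ... | no ¬p = ≤-trans (≮⇒≥ ¬p) z≤n
      ... | yes p with restrict-pos owed? (remaining a) p
      ...   | i≤j , ri<e = ≤-trans (restrict-≤ owed? (remaining a) i)
                             (covers a i z′≤a a≤e i≤j ri<e p′ (released-from-run-start i i≤j p′))
        where p′ = ≤-trans p (restrict-≤ owed? (remaining a) i)
      owed≤room : owedWork a ≤ e ∸ a
      owed≤room = ≤-trans (sum-mono done-by-S) (∑-countSlots≤ S a (e ∸ a))

module Construction {n : ℕ} (I : Instance n) (SA : StandingAssumptions I) (s k′ : Fin n) (θ : ℕ) (rs≤θ : r I s ≤ θ)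
    (cstar≤θ : ∀ j → j Fin.≤ k′ → r I s ≤ r I j → r I j < θ → Σ ℕ λ c → IsCstar I s j c × c ≤ θ)
    (Q : Schedule n) (cQ : ℕ) (Q-sk : SKSchedule I s k′ Q cQ) (θ<cQ : θ < cQ) where

  open SlotCounting I
  open ScheduleFacts I
  open StandingAssumptions SA

  rs : ℕ
  rs = r I s

  deadline-mono : ∀ {i j} → i Fin.≤ j → d I i ≤ d I j
  deadline-mono {i} {j} i≤j with m≤n⇒m<n∨m≡n i≤j
  ... | inj₁ i<j  = <⇒≤ (deadlines-increasing i j i<j)
  ... | inj₂ i≡j rewrite Fin.toℕ-injective i≡j = ≤-refl

  InJ : Pred (Fin n) 0ℓ
  InJ i = i Fin.≤ k′ × rs ≤ r I i × r I i < θ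

  inJ? : Decidable InJ
  inJ? i = i Fin.≤? k′ ×-dec rs ≤? r I i ×-dec r I i <? θ

  Q-valid : Valid I Q
  Q-valid = proj₁ Q-sk

  Q-edf : EDF I Q
  Q-edf = proj₁ (proj₂ Q-sk)

  Q-scheduled : ∀ i → Scheduled I Q i ⇔ (i Fin.≤ k′ × rs ≤ r I i × r I i < cQ)
  Q-scheduled = proj₂ (proj₂ (proj₂ (proj₂ Q-sk)))

  Q-inJ : ∀ {t i} → Q t ≡ just i → t < θ → InJ i
  Q-inJ {t} {i} Qt t<θ with Equivalence.to (Q-scheduled i) (t , Qt)
  ... | i≤k′ , rs≤ri , _ = i≤k′ , rs≤ri , ≤-<-trans (valid-startsFrom Q-valid i t Qt) t<θ

  Q-work : ∀ {i} → InJ i → slotsBefore Q i (d I i) ≡ p I i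
  Q-work {i} (i≤k′ , rs≤ri , ri<θ) = valid-work Q-valid i (Equivalence.from (Q-scheduled i) (i≤k′ , rs≤ri , <-trans ri<θ θ<cQ))

  Q-slotsFrom : ℕ → Fin n → ℕ
  Q-slotsFrom x i = countSlots I Q i x (d I i ∸ x)

  workFrom : ℕ → Fin n → ℕ
  workFrom x = restrict inJ? (Q-slotsFrom x)

  workFrom-inJ : ∀ {x i} → 0 < workFrom x i → InJ i
  workFrom-inJ {x} = restrict-pos inJ? (Q-slotsFrom x)

  Q-slotsFrom≤work : ∀ x i → Q-slotsFrom x i ≤ slotsBefore Q i (d I i)
  Q-slotsFrom≤work x i = ≤-trans (countSlots≤slotsBefore Q i x _)
    (≤-reflexive (slotsBefore-endsBy Q i (valid-endsBy Q-valid i) (m≤n+m∸n (d I i) x)))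

  workFrom≤p : ∀ x i → workFrom x i ≤ p I i
  workFrom≤p x i with 0 <? workFrom x i
  ... | no ¬pos = ≤-trans (≮⇒≥ ¬pos) z≤n
  ... | yes pos = ≤-trans (restrict-≤ inJ? (Q-slotsFrom x) i)
                          (≤-trans (Q-slotsFrom≤work x i) (≤-reflexive (Q-work (workFrom-inJ {x} pos))))

  workFrom-suc : ∀ x i → workFrom (suc x) i ≤ workFrom x i
  workFrom-suc x = restrict-mono inJ? λ i → countSlots-from-suc Q i x (d I i)

  workFrom-slot : ∀ {x i} → 0 < workFrom x i → ∃ λ t → x ≤ t × Q t ≡ just i
  workFrom-slot {x} {i} pos with countSlots-pos Q i x (d I i ∸ x) (≤-trans pos (restrict-≤ inJ? (Q-slotsFrom x) i))
  ... | t , x≤t , _ , Qt = t , x≤t , Qt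

  record CstarSchedule (j : Fin n) : Set where
    field
      S           : Schedule n
      c           : ℕ
      c≤θ         : c ≤ θ
      rj<c        : r I j < c
      work-before : ∀ i → i Fin.≤ j → InJ i → r I i < c → ∀ a → a ≤ r I i → p I i ≤ countSlots I S i a (c ∸ a)

  cstar-schedule : ∀ {j} → InJ j → CstarSchedule j
  cstar-schedule {j} (j≤k′ , rs≤rj , rj<θ) with cstar≤θ j j≤k′ rs≤rj rj<θ
  ... | c , ((k , S , cm , j≤k , S-sk , completion@(t , 1+t≡c , St , _)) , _) , c≤θ = record
    { S = S ; c = c ; c≤θ = c≤θ ; rj<c = rj<c ; work-before = work-before }
    where
    S-valid = proj₁ S-sk
    S-edf = proj₁ (proj₂ S-sk)
    S-scheduled = proj₂ (proj₂ (proj₂ (proj₂ S-sk)))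

    rj<c : r I j < c
    rj<c = ≤-trans (s≤s (valid-startsFrom S-valid j t St)) (≤-reflexive 1+t≡c)

    c≤cm : c ≤ cm
    c≤cm with proj₁ (proj₂ (proj₂ S-sk))
    ... | inj₁ (empty , _)  = case trans (sym St) (empty t) of λ ()
    ... | inj₂ (_ , ≤cmax) = ≤cmax j c completion

    endsBy-c : ∀ {i} → i Fin.≤ j → r I i < c → EndsBy S i c
    endsBy-c {i} i≤j ri<c with m≤n⇒m<n∨m≡n i≤j
    ... | inj₁ i<j = edf-endsBy-completion S-edf completion (deadlines-increasing i j i<j) ri<c
    ... | inj₂ i≡j rewrite Fin.toℕ-injective i≡j = completion-endsBy completion

    work-before : ∀ i → i Fin.≤ j → InJ i → r I i < c → ∀ a → a ≤ r I i → p I i ≤ countSlots I S i a (c ∸ a)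
    work-before i i≤j (_ , rs≤ri , _) ri<c a a≤ri = ≤-reflexive (begin
      p I i                       ≡⟨ valid-work S-valid i scheduled ⟨
      slotsBefore S i (d I i)     ≡⟨ slotsBefore-endsBy S i (valid-endsBy S-valid i) (m≤n+m (d I i) c) ⟨
      slotsBefore S i (c + d I i) ≡⟨ slotsBefore-endsBy S i (endsBy-c i≤j ri<c) (m≤m+n c (d I i)) ⟩
      slotsBefore S i c           ≡⟨ countSlots-covering S i a (c ∸ a) (valid-startsFrom S-valid i) (endsBy-c i≤j ri<c) a≤ri (m≤n+m∸n c a) ⟨
      countSlots I S i a (c ∸ a) ∎)
      where
      open ≡-Reasoning
      scheduled = Equivalence.from (S-scheduled i) (Fin.≤-trans i≤j j≤k , rs≤ri , <-≤-trans ri<c c≤cm)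

  module FreshGreedy (z₀ : ℕ) (ρ₀ : Fin n → ℕ) (ρ₀-inJ : ∀ {i} → 0 < ρ₀ i → InJ i) (ρ₀≤p : ∀ i → ρ₀ i ≤ p I i) where
    open Greedy I z₀ ρ₀

    -- compare with the C*-schedule of a job left unfinished at θ
    greedy-finishes : ∀ {z′} → z₀ ≤ z′ → z′ ≤ θ → (∀ i → 0 < remaining z′ i → z′ ≤ r I i) → ∀ j → remaining θ j ≡ 0
    greedy-finishes {z′} z₀≤z′ z′≤θ fresh j with 0 <? remaining θ j
    ... | no ¬pos = n≤0⇒n≡0 (≮⇒≥ ¬pos)
    ... | yes pos = ⊥-elim (unfinished-uncoverable z₀≤z′ z′≤c (≤-trans pos (remaining-anti j c≤θ)) rj<c S covers)
      where
      open CstarSchedule (cstar-schedule (ρ₀-inJ (≤-trans pos (remaining≤ρ θ j))))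
      z′≤c : z′ ≤ c
      z′≤c = ≤-trans (fresh j (≤-trans pos (remaining-anti j z′≤θ))) (<⇒≤ rj<c)
      done-by-S : ∀ a i → i Fin.≤ j → r I i < c → 0 < remaining a i → a ≤ r I i → remaining a i ≤ countSlots I S i a (c ∸ a)
      done-by-S a i i≤j ri<c pos-a a≤ri = begin
        remaining a i               ≤⟨ remaining≤ρ a i ⟩
        ρ₀ i                        ≤⟨ ρ₀≤p i ⟩
        p I i                       ≤⟨ work-before i i≤j (ρ₀-inJ (≤-trans pos-a (remaining≤ρ a i))) ri<c a a≤ri ⟩
        countSlots I S i a (c ∸ a) ∎
        where open ≤-Reasoning
      covers : Covers S j z′ c
      covers a i _ _ i≤j ri<c pos-a (inj₁ refl) = done-by-S a i i≤j ri<c pos-a (fresh i pos-a)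
      covers a i _ _ i≤j ri<c pos-a (inj₂ a≤ri) = done-by-S a i i≤j ri<c pos-a a≤ri

  ∑workFrom : ℕ → ℕ
  ∑workFrom x = sum (workFrom x)

  -- greedy started at r_s is fresh there, so it finishes J by θ at one unit of work per slot
  ∑workFrom-rs : ∑workFrom rs ≤ θ ∸ rs
  ∑workFrom-rs = begin
    ∑workFrom rs                          ≡⟨ sum-cong (λ i → remaining-until-start i ≤-refl) ⟨
    ∑remaining rs                         ≤⟨ ∑remaining-drop rs (θ ∸ rs) ⟩
    θ ∸ rs + ∑remaining (rs + (θ ∸ rs))   ≡⟨ cong (λ t → θ ∸ rs + ∑remaining t) (m+[n∸m]≡n rs≤θ) ⟩
    θ ∸ rs + ∑remaining θ                 ≡⟨ cong (θ ∸ rs +_) (sum-zero (remaining θ) (greedy-finishes ≤-refl rs≤θ fresh)) ⟩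
    θ ∸ rs + 0                            ≡⟨ +-identityʳ _ ⟩
    θ ∸ rs ∎
    where
    open ≤-Reasoning
    open Greedy I rs (workFrom rs)
    open FreshGreedy rs (workFrom rs) (workFrom-inJ {rs}) (workFrom≤p rs)
    fresh : ∀ i → 0 < remaining rs i → rs ≤ r I i
    fresh i pos = proj₁ (proj₂ (workFrom-inJ {rs} (≤-trans pos (remaining≤ρ rs i))))

  -- the intermediate value theorem for x ↦ ∑workFrom x + x, which rises by at most one per step
  split-point : ∃ λ z → rs ≤ z × z ≤ θ × ∑workFrom z ≡ θ ∸ z
  split-point with discrete-ivt (λ x → ∑workFrom x + x) step rs≤θ start (m≤n+m θ _)
    where
    step : ∀ x → ∑workFrom (suc x) + suc x ≤ suc (∑workFrom x + x)
    step x = ≤-trans (≤-reflexive (+-suc _ x)) (s≤s (+-monoˡ-≤ x (sum-mono (workFrom-suc x))))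
    start : ∑workFrom rs + rs ≤ θ
    start = ≤-trans (+-monoˡ-≤ rs ∑workFrom-rs) (≤-reflexive (m∸n+n≡m rs≤θ))
  ... | z , rs≤z , z≤θ , balanced = z , rs≤z , z≤θ , trans (sym (m+n∸n≡m _ z)) (cong (_∸ z) balanced)

  module Splice (z : ℕ) (rs≤z : rs ≤ z) (z≤θ : z ≤ θ) (balanced : ∑workFrom z ≡ θ ∸ z) where
    open Greedy I z (workFrom z)
    open FreshGreedy z (workFrom z) (workFrom-inJ {z}) (workFrom≤p z)

    ∑remaining-z : ∑remaining z ≡ θ ∸ z
    ∑remaining-z = trans (sum-cong (λ i → remaining-until-start i ≤-refl)) balanced

    -- after an idle slot greedy is fresh, so it would finish its θ - z units of work in fewer slots
    greedy-busy : ∀ t → z ≤ t → t < θ → greedy t ≢ nothing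
    greedy-busy t z≤t t<θ idle = <⇒≱ shorter (begin
      θ ∸ z                                                    ≡⟨ ∑remaining-z ⟨
      ∑remaining z                                             ≤⟨ ∑remaining-drop z (t ∸ z) ⟩
      t ∸ z + ∑remaining (z + (t ∸ z))                         ≡⟨ cong (λ y → t ∸ z + ∑remaining y) (m+[n∸m]≡n z≤t) ⟩
      t ∸ z + ∑remaining t                                     ≡⟨ cong (t ∸ z +_) (∑remaining-idle t idle) ⟩
      t ∸ z + ∑remaining (suc t)                               ≤⟨ +-monoʳ-≤ (t ∸ z) (∑remaining-drop (suc t) (θ ∸ suc t)) ⟩
      t ∸ z + (θ ∸ suc t + ∑remaining (suc t + (θ ∸ suc t)))   ≡⟨ cong (λ y → t ∸ z + (θ ∸ suc t + ∑remaining y)) (m+[n∸m]≡n t<θ) ⟩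
      t ∸ z + (θ ∸ suc t + ∑remaining θ)                       ≡⟨ cong (λ y → t ∸ z + (θ ∸ suc t + y)) (sum-zero (remaining θ) done) ⟩
      t ∸ z + (θ ∸ suc t + 0)                                  ≡⟨ cong (t ∸ z +_) (+-identityʳ _) ⟩
      t ∸ z + (θ ∸ suc t) ∎)
      where
      open ≤-Reasoning
      shorter : t ∸ z + (θ ∸ suc t) < θ ∸ z
      shorter = begin-strict
        t ∸ z + (θ ∸ suc t)   <⟨ +-monoʳ-< (t ∸ z) (∸-monoʳ-< (n<1+n t) t<θ) ⟩
        t ∸ z + (θ ∸ t)       ≡⟨ ∸-telescope z≤t (<⇒≤ t<θ) ⟩
        θ ∸ z ∎
      fresh : ∀ i → 0 < remaining (suc t) i → suc t ≤ r I i
      fresh i pos with suc t ≤? r I i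
      ... | yes t<ri = t<ri
      ... | no t≮ri = ⊥-elim (greedy-idle idle z≤t i (≤-pred (≰⇒> t≮ri) , ≤-trans pos (remaining-anti i (n≤1+n t))))
      done : ∀ i → remaining θ i ≡ 0
      done = greedy-finishes (m≤n⇒m≤1+n z≤t) t<θ fresh

    greedy-done-by-θ : ∀ i → remaining θ i ≡ 0
    greedy-done-by-θ i = n≤0⇒n≡0 (≤-trans (≤-sum (remaining θ) i) (≤-reflexive ∑remaining-θ))
      where
      ∑remaining-θ : ∑remaining θ ≡ 0
      ∑remaining-θ = +-cancelˡ-≡ (θ ∸ z) _ _ (begin
        θ ∸ z + ∑remaining θ                    ≡⟨ cong (λ y → θ ∸ z + ∑remaining y) (m+[n∸m]≡n z≤θ) ⟨
        θ ∸ z + ∑remaining (z + (θ ∸ z))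
          ≡⟨ ∑remaining-busy z (θ ∸ z) (λ t z≤t t<z+θ-z → greedy-busy t z≤t (≤-trans t<z+θ-z (≤-reflexive (m+[n∸m]≡n z≤θ)))) ⟨
        ∑remaining z                            ≡⟨ ∑remaining-z ⟩
        θ ∸ z                                   ≡⟨ +-identityʳ _ ⟨
        θ ∸ z + 0 ∎)
        where open ≡-Reasoning

    -- Q itself does, after any a ∈ [z, d_i], all the work greedy owes at a on jobs up to i
    greedy-done-by-deadline : ∀ i → remaining (d I i) i ≡ 0
    greedy-done-by-deadline i with 0 <? remaining (d I i) i
    ... | no ¬pos = n≤0⇒n≡0 (≮⇒≥ ¬pos)
    ... | yes pos with workFrom-slot {z} (≤-trans pos (remaining≤ρ (d I i) i))
    ...   | t , z≤t , Qt = ⊥-elim (unfinished-uncoverable ≤-refl z≤di pos ri<di Q covers)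
      where
      z≤di : z ≤ d I i
      z≤di = ≤-trans z≤t (<⇒≤ (valid-endsBy Q-valid i t Qt))
      ri<di : r I i < d I i
      ri<di = ≤-<-trans (valid-startsFrom Q-valid i t Qt) (valid-endsBy Q-valid i t Qt)
      Q-does : ∀ {a i′} → i′ Fin.≤ i → a ≡ z ⊎ a ≤ r I i′ →
               Q-slotsFrom z i′ ≤ countSlots I Q i′ a (d I i ∸ a)
      Q-does {a} {i′} i′≤i (inj₁ refl) = countSlots-monoʳ Q i′ z (∸-monoˡ-≤ z (deadline-mono i′≤i))
      Q-does {a} {i′} i′≤i (inj₂ a≤ri′) = ≤-trans (Q-slotsFrom≤work z i′) (≤-reflexive (sym
        (countSlots-covering Q i′ a (d I i ∸ a) (valid-startsFrom Q-valid i′) (valid-endsBy Q-valid i′) a≤ri′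
                             (≤-trans (deadline-mono i′≤i) (m≤n+m∸n (d I i) a)))))
      covers : Covers Q i z (d I i)
      covers a i′ _ _ i′≤i _ _ a≡z⊎a≤ri′ = ≤-trans (remaining≤ρ a i′)
        (≤-trans (restrict-≤ inJ? (Q-slotsFrom z) i′) (Q-does i′≤i a≡z⊎a≤ri′))

    greedy-slot : ∀ {t i} → greedy t ≡ just i → InJ i × r I i ≤ t × t < d I i × t < θ
    greedy-slot {t} {i} Gt = workFrom-inJ {z} (≤-trans (greedy-unfinished Gt) (remaining≤ρ t i)) ,
      greedy-released Gt , before (greedy-done-by-deadline i) , before (greedy-done-by-θ i)
      where
      before : ∀ {y} → remaining y i ≡ 0 → t < y
      before {y} done with t <? y
      ... | yes t<y = t<y
      ... | no t≮y  = ⊥-elim (<⇒≱ (greedy-unfinished Gt) (≤-trans (remaining-anti i (≮⇒≥ t≮y)) (≤-reflexive done)))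

    greedy-slots-from-z : ∀ {i} → InJ i → countSlots I greedy i z (d I i ∸ z) ≡ Q-slotsFrom z i
    greedy-slots-from-z {i} i∈J = begin
      countSlots I greedy i z m                                 ≡⟨ +-identityʳ _ ⟨
      countSlots I greedy i z m + 0                             ≡⟨ cong (countSlots I greedy i z m +_) done ⟨
      countSlots I greedy i z m + remaining (z + m) i           ≡⟨ countSlots-greedy i z m ⟩
      remaining z i                                             ≡⟨ remaining-until-start i ≤-refl ⟩
      workFrom z i                                              ≡⟨ restrict-yes inJ? (Q-slotsFrom z) i∈J ⟩
      Q-slotsFrom z i ∎
      where
      open ≡-Reasoning
      m = d I i ∸ z
      done : remaining (z + m) i ≡ 0
      done = n≤0⇒n≡0 (≤-trans (remaining-anti i (m≤n+m∸n (d I i) z)) (≤-reflexive (greedy-done-by-deadline i)))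

    spliced : Schedule n
    spliced t with t <? z
    ... | yes _ = Q t
    ... | no _  = greedy t

    spliced-before : ∀ {t} → t < z → spliced t ≡ Q t
    spliced-before {t} t<z with t <? z
    ... | yes _   = refl
    ... | no t≮z = ⊥-elim (t≮z t<z)

    spliced-after : ∀ {t} → z ≤ t → spliced t ≡ greedy t
    spliced-after {t} z≤t with t <? z
    ... | yes t<z = ⊥-elim (<⇒≱ t<z z≤t)
    ... | no _    = refl

    spliced-slot : ∀ {t i} → spliced t ≡ just i → InJ i × r I i ≤ t × t < d I i × t < θ
    spliced-slot {t} {i} St with t <? z
    ... | yes t<z = Q-inJ St t<θ , valid-startsFrom Q-valid i t St , valid-endsBy Q-valid i t St , t<θ
      where t<θ = <-≤-trans t<z z≤θ
    ... | no _    = greedy-slot St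

    spliced-startsFrom : ∀ i → StartsFrom spliced i (r I i)
    spliced-startsFrom i t St = proj₁ (proj₂ (spliced-slot St))

    spliced-endsBy : ∀ i → EndsBy spliced i (d I i)
    spliced-endsBy i t St = proj₁ (proj₂ (proj₂ (spliced-slot St)))

    spliced-work : ∀ {i} → InJ i → countSlots I spliced i (r I i) (d I i ∸ r I i) ≡ p I i
    spliced-work {i} i∈J = begin
      countSlots I spliced i (r I i) (d I i ∸ r I i)
        ≡⟨ countSlots-covering spliced i (r I i) (d I i ∸ r I i) (spliced-startsFrom i) (spliced-endsBy i) ≤-refl (m≤n+m∸n (d I i) (r I i)) ⟩
      slotsBefore spliced i (d I i)                        ≡⟨ slotsBefore-endsBy spliced i (spliced-endsBy i) (m≤n+m∸n (d I i) z) ⟨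
      slotsBefore spliced i (z + m)                        ≡⟨ slotsBefore-++ spliced i z m ⟩
      slotsBefore spliced i z + countSlots I spliced i z m
        ≡⟨ cong₂ _+_ (countSlots-cong i 0 z λ _ _ t<z → spliced-before t<z) (countSlots-cong i z m λ _ z≤t _ → spliced-after z≤t) ⟩
      slotsBefore Q i z + countSlots I greedy i z m        ≡⟨ cong (slotsBefore Q i z +_) (greedy-slots-from-z i∈J) ⟩
      slotsBefore Q i z + countSlots I Q i z m             ≡⟨ slotsBefore-++ Q i z m ⟨
      slotsBefore Q i (z + m)                              ≡⟨ slotsBefore-endsBy Q i (valid-endsBy Q-valid i) (m≤n+m∸n (d I i) z) ⟩
      slotsBefore Q i (d I i)                              ≡⟨ Q-work i∈J ⟩
      p I i ∎
      where
      open ≡-Reasoning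
      m = d I i ∸ z

    spliced-valid : Valid I spliced
    spliced-valid = (λ t i St → spliced-startsFrom i t St , spliced-endsBy i t St) ,
                    (λ i (t , St) → spliced-work (proj₁ (spliced-slot St)))

    spliced-schedules-J : ∀ {i} → InJ i → Scheduled I spliced i
    spliced-schedules-J {i} i∈J with countSlots-pos spliced i (r I i) (d I i ∸ r I i)
                                       (≤-trans (processing-positive i) (≤-reflexive (sym (spliced-work i∈J))))
    ... | t , _ , _ , St = t , St

    spliced-edf : EDF I spliced
    spliced-edf t j St i (ri≤t , t′ , t≤t′ , St′) with t <? z
    ... | yes t<z = Q-edf t j St i (ri≤t , Q-pending)
      where
      Q-pending : ∃ λ t″ → t ≤ t″ × Q t″ ≡ just i
      Q-pending = from (t′ <? z)
        where
        from : Dec (t′ < z) → ∃ λ t″ → t ≤ t″ × Q t″ ≡ just i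
        from (yes t′<z) = t′ , t≤t′ , trans (sym (spliced-before t′<z)) St′
        from (no t′≮z) with workFrom-slot {z} (≤-trans (greedy-pending Gt′ (≮⇒≥ t′≮z)) (remaining≤ρ z i))
          where Gt′ = trans (sym (spliced-after (≮⇒≥ t′≮z))) St′
        ... | t″ , z≤t″ , Qt″ = t″ , ≤-trans (<⇒≤ t<z) z≤t″ , Qt″
    ... | no t≮z = deadline-mono (greedy-least St i (ri≤t , greedy-pending Gt′ t≤t′))
      where Gt′ = trans (sym (spliced-after (≤-trans (≮⇒≥ t≮z) t≤t′))) St′

    idle? : Decidable (λ t → spliced t ≡ nothing)
    idle? t with spliced t
    ... | nothing = yes refl
    ... | just _  = no λ ()

    open MaximalRun (maximalRun idle? θ rs≤θ) public
      renaming (start to cR; lo≤start to rs≤cR; start≤hi to cR≤θ; holds to idle-from-cR; maximal to busy-before-cR)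

    spliced-ends-by-cR : ∀ {t i} → spliced t ≡ just i → t < cR
    spliced-ends-by-cR {t} St with t <? cR
    ... | yes t<cR = t<cR
    ... | no t≮cR  = case trans (sym St) (idle-from-cR t (≮⇒≥ t≮cR) (proj₂ (proj₂ (proj₂ (spliced-slot St))))) of λ ()

    spliced-cmax : IsCmax I rs spliced cR
    spliced-cmax with busy-before-cR
    ... | inj₁ cR≡rs = inj₁ (empty , cR≡rs)
      where
      empty : EmptySchedule I spliced
      empty t with spliced t in St
      ... | nothing = refl
      ... | just i with spliced-slot St
      ...   | (_ , rs≤ri , _) , ri≤t , _ =
        ⊥-elim (<⇒≱ (spliced-ends-by-cR St) (≤-trans (≤-reflexive cR≡rs) (≤-trans rs≤ri ri≤t)))
    ... | inj₂ (c′ , 1+c′≡cR , _ , busy) with spliced c′ in Sc′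
    ...   | nothing = ⊥-elim (busy refl)
    ...   | just j  = inj₂ ((j , c′ , 1+c′≡cR , Sc′ , λ t cR≤t St → <⇒≱ (spliced-ends-by-cR St) cR≤t) ,
                            λ { i c (t , 1+t≡c , St , _) → subst (_≤ cR) 1+t≡c (spliced-ends-by-cR St) })

    spliced-sk : SKSchedule I s k′ spliced cR
    spliced-sk = spliced-valid , spliced-edf , spliced-cmax ,
                 ≤-trans cR≤θ (<⇒≤ (<-≤-trans θ<cQ (proj₁ (proj₂ (proj₂ (proj₂ Q-sk)))))) ,
                 λ i → mk⇔ (to i) (λ (i≤k′ , rs≤ri , ri<cR) → spliced-schedules-J (i≤k′ , rs≤ri , <-≤-trans ri<cR cR≤θ))
      where
      to : ∀ i → Scheduled I spliced i → i Fin.≤ k′ × rs ≤ r I i × r I i < cR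
      to i (t , St) with spliced-slot St
      ... | (i≤k′ , rs≤ri , _) , ri≤t , _ = i≤k′ , rs≤ri , ≤-<-trans ri≤t (spliced-ends-by-cR St)

    open GapCounting I rs

    spliced-prefix-gaps : ∀ {x} → rs ≤ x → x ≤ z → gapsFrom I spliced rs rs (x ∸ rs) ≡ gapsFrom I Q rs rs (x ∸ rs)
    spliced-prefix-gaps rs≤x x≤z =
      gapsFrom-cong rs _ λ t t<x → spliced-before (<-≤-trans t<x (≤-trans (≤-reflexive (m+[n∸m]≡n rs≤x)) x≤z))

    -- the spliced schedule has no gap in [z, θ)
    gaps-spliced≤gaps-Q : gaps I s spliced cR ≤ gaps I s Q cQ
    gaps-spliced≤gaps-Q = begin
      gapsFrom I spliced rs rs (cR ∸ rs)                                        ≤⟨ gapsFrom-mono spliced rs (∸-monoˡ-≤ rs cR≤θ) ⟩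
      gapsFrom I spliced rs rs (θ ∸ rs)                                         ≡⟨ gapsFrom-split spliced rs≤z z≤θ ⟩
      gapsFrom I spliced rs rs (z ∸ rs) + gapsFrom I spliced rs z (θ ∸ z)       ≡⟨ cong₂ _+_ (spliced-prefix-gaps rs≤z ≤-refl) (gapsFrom-busy spliced z (θ ∸ z) busy) ⟩
      gapsFrom I Q rs rs (z ∸ rs) + 0                                           ≡⟨ +-identityʳ _ ⟩
      gapsFrom I Q rs rs (z ∸ rs)                                               ≤⟨ gapsFrom-mono Q rs (∸-monoˡ-≤ rs (≤-trans z≤θ (<⇒≤ θ<cQ))) ⟩
      gapsFrom I Q rs rs (cQ ∸ rs) ∎
      where
      open ≤-Reasoning
      busy : ∀ t → z ≤ t → t < z + (θ ∸ z) → spliced t ≢ nothing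
      busy t z≤t t<θ = greedy-busy t z≤t (≤-trans t<θ (≤-reflexive (m+[n∸m]≡n z≤θ))) ∘ trans (sym (spliced-after z≤t))

    -- an early idle tail of the spliced schedule lies before z, where it is a gap of Q as well
    gaps-spliced<gaps-Q : cR < θ → gaps I s spliced cR < gaps I s Q cQ
    gaps-spliced<gaps-Q cR<θ = begin-strict
      gapsFrom I spliced rs rs (cR ∸ rs)                                        ≡⟨ spliced-prefix-gaps rs≤cR (<⇒≤ cR<z) ⟩
      gapsFrom I Q rs rs (cR ∸ rs)                                              <⟨ m<m+n _ (≤-reflexive (sym gapStart-cR)) ⟩
      gapsFrom I Q rs rs (cR ∸ rs) + gapsFrom I Q rs cR (suc cR ∸ cR)           ≡⟨ gapsFrom-split Q rs≤cR (n≤1+n cR) ⟨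
      gapsFrom I Q rs rs (suc cR ∸ rs)                                          ≤⟨ gapsFrom-mono Q rs (∸-monoˡ-≤ rs (<-trans cR<θ θ<cQ)) ⟩
      gapsFrom I Q rs rs (cQ ∸ rs) ∎
      where
      open ≤-Reasoning
      idle-cR : spliced cR ≡ nothing
      idle-cR = idle-from-cR cR ≤-refl cR<θ
      cR<z : cR < z
      cR<z with cR <? z
      ... | yes cR<z = cR<z
      ... | no cR≮z  = ⊥-elim (greedy-busy cR (≮⇒≥ cR≮z) cR<θ (trans (sym (spliced-after (≮⇒≥ cR≮z))) idle-cR))
      gap-at-cR : cR ≡ rs ⊎ ∃ λ j → Q (pred cR) ≡ just j
      gap-at-cR with busy-before-cR
      ... | inj₁ cR≡rs = inj₁ cR≡rs
      ... | inj₂ (c′ , 1+c′≡cR , _ , busy) with spliced c′ in Sc′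
      ...   | nothing = ⊥-elim (busy refl)
      ...   | just j  = inj₂ (j , trans (cong (Q ∘ pred) (sym 1+c′≡cR)) (trans (sym (spliced-before c′<z)) Sc′))
        where c′<z = <-trans (≤-reflexive 1+c′≡cR) cR<z
      gapStart-cR : gapsFrom I Q rs cR (suc cR ∸ cR) ≡ 1
      gapStart-cR rewrite m+n∸n≡m 1 cR = trans (+-identityʳ _) (gapStart-idle Q cR (trans (sym (spliced-before cR<z)) idle-cR) gap-at-cR)

lemma8 : ∀ {n} (I : Instance n) → StandingAssumptions I →
    (s k' : Fin n) (θ g : ℕ) → r I s ≤ θ →
    (∀ j → j Fin.≤ k' → r I s ≤ r I j → r I j < θ →
       Σ ℕ λ c → IsCstar I s j c × c ≤ θ) →
    (Σ (Schedule n) λ Q → Σ ℕ λ cQ →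
       SKSchedule I s k' Q cQ × θ < cQ × gaps I s Q cQ ≤ g) →
    Σ (Schedule n) λ R → Σ ℕ λ cR →
      SKSchedule I s k' R cR ×
      (∀ j → j Fin.≤ k' → r I s ≤ r I j → r I j < θ → Scheduled I R j) ×
      (cR ≤ θ × gaps I s R cR ≤ g) ×
      (cR < θ → gaps I s R cR < g)
lemma8 I SA s k′ θ g rs≤θ cstar≤θ (Q , cQ , Q-sk , θ<cQ , gaps-Q≤g)
  with Construction.split-point I SA s k′ θ rs≤θ cstar≤θ Q cQ Q-sk θ<cQ
... | z , rs≤z , z≤θ , balanced =
  spliced , cR , spliced-sk ,
  (λ j j≤k′ rs≤rj rj<θ → spliced-schedules-J (j≤k′ , rs≤rj , rj<θ)) ,
  (cR≤θ , ≤-trans gaps-spliced≤gaps-Q gaps-Q≤g) ,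
  (λ cR<θ → <-≤-trans (gaps-spliced<gaps-Q cR<θ) gaps-Q≤g)
  where open Construction.Splice I SA s k′ θ rs≤θ cstar≤θ Q cQ Q-sk θ<cQ z rs≤z z≤θ balanced
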